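{- Let $\ell \ge 1$ and $a_1,\dots,a_\ell$ be nonnegative integers, let $G = \{*L_{a_1}, \ldots, *L_{a_\ell}\}$, and let $a = \operatorname{mex}(\{a_1, \ldots, a_\ell\})$. Then $G \equiv *L_{a}$.
   Context: Positions are defined recursively: $*L$ and $*R$ are terminal positions; if $G_1,\dots,G_n$ ($n\ge 1$) are positions, then $\{G_1,\dots,G_n\}$ is a position with options $G_1,\dots,G_n$. All positions have finite game trees. Play: Left and Right move alternately, each choosing any option of the current position; when a terminal position is reached, Left wins if it is $*L$ and Right wins if it is $*R$. Disjunctive sum: $*L + *L = *R + *R = *L$, $*L + *R = *R + *L = *R$; if at least one of $G,H$ is non-terminal, $G+H$ has options all $G'+H$ ($G'$ an option of $G$) and all $G+H'$ ($H'$ an option of $H$). Outcome classes: $\mathcal{L}$ (Left wins moving first or second), $\mathcal{R}$ (Right wins moving first or second), $\mathcal{N}$ (first player wins), $\mathcal{P}$ (second player wins); $o(G)$ denotes the outcome class. Equivalence: $G \equiv H$ iff $o(G+X) = o(H+X)$ for every position $X$. Define $*L_0 = *L$ and $*L_n = \{*L_{n-1}, \ldots, *L_0\}$ for $n \ge 1$. For a set $S$ of nonnegative integers, $\operatorname{mex}(S)$ is the least nonnegative integer not in $S$. -}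

module Defs where

open import Data.Nat using (ℕ; zero; suc; _<_)
open import Data.Bool using (Bool; true; false; _∧_; _∨_; not)
open import Data.List using (List; []; _∷_; _++_)
open import Data.List.NonEmpty using (List⁺; _∷_; toList) renaming (map to map⁺)
open import Data.List.Membership.Propositional using (_∈_; _∉_)
open import Data.Product using (_×_)
open import Relation.Binary.PropositionalEquality using (_≡_)

-- Positions: terminal *L, *R, or {G₁,…,Gₙ} with n ≥ 1 options (a nonempty list).
data Pos : Set where
  *L : Pos
  *R : Pos
  ⟨_⟩ : List⁺ Pos → Pos

mutual
  infixl 6 _⊕_
  _⊕_ : Pos → Pos → Pos
  *L ⊕ *L = *L
  *L ⊕ *R = *R
  *R ⊕ *L = *R
  *R ⊕ *R = *L
  *L ⊕ ⟨ h ∷ hs ⟩ = ⟨ (*L ⊕ h) ∷ sumR *L hs ⟩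
  *R ⊕ ⟨ h ∷ hs ⟩ = ⟨ (*R ⊕ h) ∷ sumR *R hs ⟩
  ⟨ g ∷ gs ⟩ ⊕ *L = ⟨ (g ⊕ *L) ∷ sumL gs *L ⟩
  ⟨ g ∷ gs ⟩ ⊕ *R = ⟨ (g ⊕ *R) ∷ sumL gs *R ⟩
  ⟨ g ∷ gs ⟩ ⊕ ⟨ h ∷ hs ⟩ =
    ⟨ (g ⊕ ⟨ h ∷ hs ⟩) ∷ (sumL gs ⟨ h ∷ hs ⟩ ++ ((⟨ g ∷ gs ⟩ ⊕ h) ∷ sumR ⟨ g ∷ gs ⟩ hs)) ⟩

  sumL : List Pos → Pos → List Pos
  sumL [] H = []
  sumL (g ∷ gs) H = (g ⊕ H) ∷ sumL gs H

  sumR : Pos → List Pos → List Pos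
  sumR G [] = []
  sumR G (h ∷ hs) = (G ⊕ h) ∷ sumR G hs

-- leftWinsFirst G  : Left wins G when Left moves first.
-- leftWinsSecond G : Left wins G when Right moves first.
-- (Finite trees, no draws: Right wins exactly when Left does not.)
mutual
  leftWinsFirst : Pos → Bool
  leftWinsFirst *L = true
  leftWinsFirst *R = false
  leftWinsFirst ⟨ g ∷ gs ⟩ = leftWinsSecond g ∨ anyLS gs

  leftWinsSecond : Pos → Bool
  leftWinsSecond *L = true
  leftWinsSecond *R = false
  leftWinsSecond ⟨ g ∷ gs ⟩ = leftWinsFirst g ∧ allLF gs

  anyLS : List Pos → Bool
  anyLS [] = false
  anyLS (g ∷ gs) = leftWinsSecond g ∨ anyLS gs

  allLF : List Pos → Bool
  allLF [] = true
  allLF (g ∷ gs) = leftWinsFirst g ∧ allLF gs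

data Outcome : Set where
  𝓛 𝓡 𝓝 𝓟 : Outcome

outcomeOf : Bool → Bool → Outcome
outcomeOf true  true  = 𝓛
outcomeOf false false = 𝓡
outcomeOf true  false = 𝓝
outcomeOf false true  = 𝓟

o : Pos → Outcome
o G = outcomeOf (leftWinsFirst G) (leftWinsSecond G)

infix 4 _≡ᵍ_
_≡ᵍ_ : Pos → Pos → Set
G ≡ᵍ H = (X : Pos) → o (G ⊕ X) ≡ o (H ⊕ X)

mutual
  starL : ℕ → Pos
  starL zero = *L
  starL (suc n) = ⟨ starL n ∷ starLs n ⟩

  starLs : ℕ → List Pos
  starLs zero = []
  starLs (suc n) = starL n ∷ starLs n

IsMex : List ℕ → ℕ → Set
IsMex S a = (a ∉ S) × ((b : ℕ) → b < a → b ∈ S)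

gameOf : List⁺ ℕ → Pos
gameOf as = ⟨ map⁺ starL as ⟩

-- Induction on X, showing that Y = {*L_{a₁}, …, *L_{aℓ}} and *L_a give sums Y ⊕ X and
-- *L_a ⊕ X with the same winner whoever starts. Both players have the same moves, so a move
-- inside X is copied into the other sum and handled by the induction hypothesis. A move
-- *L_a → *L_b has b < a, so b is some aᵢ and Y offers the same move. A move Y → *L_n has
-- n ≠ a by the mex property, and the *L_k form a chain in which each is an option of every
-- larger one: if n < a the move is also available from *L_a, and if n > a then *L_a ⊕ X is
-- an option of *L_n ⊕ X, so whoever wins *L_n ⊕ X moving second wins *L_a ⊕ X moving first.

module Submission where

open import Defs
open import Data.Nat using (ℕ; zero; suc; _<_)
open import Data.Nat.Properties using (<-cmp)
open import Data.Bool using (Bool; true; false; T; not; _∧_; _∨_)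
open import Data.Bool.Properties using (T-∧; T-∨; T-not-≡; ∨-∧-booleanAlgebra)
open import Algebra.Lattice.Properties.BooleanAlgebra ∨-∧-booleanAlgebra using (deMorgan₁; deMorgan₂)
open import Data.List using (List; []; _∷_; _++_; map; applyDownFrom)
open import Data.Bool.ListAction using (any; all)
open import Data.List.Properties using (++-identityʳ)
open import Data.List.NonEmpty using (List⁺; _∷_; toList)
open import Data.List.Relation.Unary.Any.Properties using (any⁺; any⁻)
open import Data.List.Relation.Unary.Any using (here)
open import Data.List.Relation.Unary.All as All using (All; []; _∷_)
open import Data.List.Relation.Unary.All.Properties using (all⁺; all⁻; ¬All⇒Any¬)
open import Data.List.Membership.Propositional using (_∈_; find; lose)
open import Data.List.Membership.Propositional.Properties
  using (∈-map⁺; ∈-map⁻; ∈-++⁺ˡ; ∈-++⁺ʳ; ∈-++⁻; ∈-applyDownFrom⁺; ∈-applyDownFrom⁻)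
open import Data.Product using (∃; _×_; _,_; proj₁; proj₂)
open import Data.Sum using (_⊎_; inj₁; inj₂)
open import Data.Empty using (⊥-elim)
open import Function using (_∘_; Equivalence)
open import Relation.Nullary using (¬_; contradiction)
open import Relation.Nullary.Decidable using (T?)
open import Relation.Binary.Definitions using (tri<; tri≈; tri>)
open import Relation.Binary.PropositionalEquality
  using (_≡_; _≢_; refl; sym; trans; cong; cong₂; subst)

open Equivalence using (to; from)

options : Pos → List Pos
options *L = []
options *R = []
options ⟨ gs ⟩ = toList gs

sumL≡map : ∀ gs X → sumL gs X ≡ map (_⊕ X) gs
sumL≡map [] X = refl
sumL≡map (g ∷ gs) X = cong (g ⊕ X ∷_) (sumL≡map gs X)

sumR≡map : ∀ G xs → sumR G xs ≡ map (G ⊕_) xs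
sumR≡map G [] = refl
sumR≡map G (x ∷ xs) = cong (G ⊕ x ∷_) (sumR≡map G xs)

options-⊕ : ∀ G X → options (G ⊕ X) ≡ map (_⊕ X) (options G) ++ map (G ⊕_) (options X)
options-⊕ *L *L = refl
options-⊕ *L *R = refl
options-⊕ *R *L = refl
options-⊕ *R *R = refl
options-⊕ *L ⟨ x ∷ xs ⟩ = cong (*L ⊕ x ∷_) (sumR≡map *L xs)
options-⊕ *R ⟨ x ∷ xs ⟩ = cong (*R ⊕ x ∷_) (sumR≡map *R xs)
options-⊕ ⟨ g ∷ gs ⟩ *L = cong (g ⊕ *L ∷_) (trans (sumL≡map gs *L) (sym (++-identityʳ _)))
options-⊕ ⟨ g ∷ gs ⟩ *R = cong (g ⊕ *R ∷_) (trans (sumL≡map gs *R) (sym (++-identityʳ _)))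
options-⊕ G@(⟨ g ∷ gs ⟩) X@(⟨ x ∷ xs ⟩) =
  cong (g ⊕ X ∷_) (cong₂ _++_ (sumL≡map gs X) (cong (G ⊕ x ∷_) (sumR≡map G xs)))

data SumOption (G X : Pos) : Pos → Set where
  inˡ : ∀ {g} → g ∈ options G → SumOption G X (g ⊕ X)
  inʳ : ∀ {x} → x ∈ options X → SumOption G X (G ⊕ x)

∈-options-⊕⁺ : ∀ {G X w} → SumOption G X w → w ∈ options (G ⊕ X)
∈-options-⊕⁺ {G} {X} (inˡ g∈) rewrite options-⊕ G X = ∈-++⁺ˡ (∈-map⁺ (_⊕ X) g∈)
∈-options-⊕⁺ {G} {X} (inʳ x∈) rewrite options-⊕ G X = ∈-++⁺ʳ (map (_⊕ X) (options G)) (∈-map⁺ (G ⊕_) x∈)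

∈-options-⊕⁻ : ∀ {G X w} → w ∈ options (G ⊕ X) → SumOption G X w
∈-options-⊕⁻ {G} {X} w∈ rewrite options-⊕ G X with ∈-++⁻ (map (_⊕ X) (options G)) w∈
... | inj₁ w∈ˡ with _ , g∈ , refl ← ∈-map⁻ (_⊕ X) w∈ˡ = inˡ g∈
... | inj₂ w∈ʳ with _ , x∈ , refl ← ∈-map⁻ (G ⊕_) w∈ʳ = inʳ x∈

anyLS≡any : ∀ gs → anyLS gs ≡ any leftWinsSecond gs
anyLS≡any [] = refl
anyLS≡any (g ∷ gs) = cong (leftWinsSecond g ∨_) (anyLS≡any gs)

allLF≡all : ∀ gs → allLF gs ≡ all leftWinsFirst gs
allLF≡all [] = refl
allLF≡all (g ∷ gs) = cong (leftWinsFirst g ∧_) (allLF≡all gs)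

leftWinsFirst-option : ∀ {G g} → g ∈ options G → T (leftWinsSecond g) → T (leftWinsFirst G)
leftWinsFirst-option {⟨ gs ⟩} g∈ win =
  subst T (sym (anyLS≡any (toList gs))) (any⁺ leftWinsSecond (lose g∈ win))

leftWinsSecond-option : ∀ {G g} → g ∈ options G → T (leftWinsSecond G) → T (leftWinsFirst g)
leftWinsSecond-option {⟨ gs ⟩} g∈ win =
  All.lookup (all⁺ leftWinsFirst (toList gs) (subst T (allLF≡all (toList gs)) win)) g∈

leftWinsFirst-⊕-option : ∀ G X {w} → SumOption G X w →
                         T (leftWinsSecond w) → T (leftWinsFirst (G ⊕ X))
leftWinsFirst-⊕-option G X w∈ = leftWinsFirst-option {G ⊕ X} (∈-options-⊕⁺ w∈)

leftWinsSecond-⊕-option : ∀ G X {w} → SumOption G X w →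
                          T (leftWinsSecond (G ⊕ X)) → T (leftWinsFirst w)
leftWinsSecond-⊕-option G X w∈ = leftWinsSecond-option {G ⊕ X} (∈-options-⊕⁺ w∈)

leftWinsFirst-elim : ∀ {G} → T (leftWinsFirst G) →
                     G ≡ *L ⊎ ∃ λ g → g ∈ options G × T (leftWinsSecond g)
leftWinsFirst-elim {*L} _ = inj₁ refl
leftWinsFirst-elim {⟨ gs ⟩} win =
  inj₂ (find (any⁻ leftWinsSecond (toList gs) (subst T (anyLS≡any (toList gs)) win)))

leftWinsSecond-elim : ∀ {G} → ¬ T (leftWinsSecond G) →
                      G ≡ *R ⊎ ∃ λ g → g ∈ options G × ¬ T (leftWinsFirst g)
leftWinsSecond-elim {*L} loss = contradiction _ loss
leftWinsSecond-elim {*R} _ = inj₁ refl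
leftWinsSecond-elim {⟨ gs ⟩} loss =
  inj₂ (find (¬All⇒Any¬ (T? ∘ leftWinsFirst) (toList gs)
    (loss ∘ subst T (sym (allLF≡all (toList gs))) ∘ all⁻ leftWinsFirst)))

mutual
  ⊕-identityʳ : ∀ G → G ⊕ *L ≡ G
  ⊕-identityʳ *L = refl
  ⊕-identityʳ *R = refl
  ⊕-identityʳ ⟨ g ∷ gs ⟩ = cong₂ (λ h hs → ⟨ h ∷ hs ⟩) (⊕-identityʳ g) (sumL-identityʳ gs)

  sumL-identityʳ : ∀ gs → sumL gs *L ≡ gs
  sumL-identityʳ [] = refl
  sumL-identityʳ (g ∷ gs) = cong₂ _∷_ (⊕-identityʳ g) (sumL-identityʳ gs)

-- Adding *R flips every terminal; as both players have the same moves, this swaps the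
-- roles of winning as first and as second player.
mutual
  leftWinsFirst-⊕*R : ∀ G → leftWinsFirst (G ⊕ *R) ≡ not (leftWinsSecond G)
  leftWinsFirst-⊕*R *L = refl
  leftWinsFirst-⊕*R *R = refl
  leftWinsFirst-⊕*R ⟨ g ∷ gs ⟩ =
    trans (cong₂ _∨_ (leftWinsSecond-⊕*R g) (anyLS-⊕*R gs)) (sym (deMorgan₁ (leftWinsFirst g) (allLF gs)))

  leftWinsSecond-⊕*R : ∀ G → leftWinsSecond (G ⊕ *R) ≡ not (leftWinsFirst G)
  leftWinsSecond-⊕*R *L = refl
  leftWinsSecond-⊕*R *R = refl
  leftWinsSecond-⊕*R ⟨ g ∷ gs ⟩ =
    trans (cong₂ _∧_ (leftWinsFirst-⊕*R g) (allLF-⊕*R gs)) (sym (deMorgan₂ (leftWinsSecond g) (anyLS gs)))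

  anyLS-⊕*R : ∀ gs → anyLS (sumL gs *R) ≡ not (allLF gs)
  anyLS-⊕*R [] = refl
  anyLS-⊕*R (g ∷ gs) =
    trans (cong₂ _∨_ (leftWinsSecond-⊕*R g) (anyLS-⊕*R gs)) (sym (deMorgan₁ (leftWinsFirst g) (allLF gs)))

  allLF-⊕*R : ∀ gs → allLF (sumL gs *R) ≡ not (anyLS gs)
  allLF-⊕*R [] = refl
  allLF-⊕*R (g ∷ gs) =
    trans (cong₂ _∧_ (leftWinsFirst-⊕*R g) (allLF-⊕*R gs)) (sym (deMorgan₂ (leftWinsSecond g) (anyLS gs)))

⟨⟩⊕≢*L : ∀ gs X → ⟨ gs ⟩ ⊕ X ≢ *L
⟨⟩⊕≢*L (g ∷ gs) *L ()
⟨⟩⊕≢*L (g ∷ gs) *R ()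
⟨⟩⊕≢*L (g ∷ gs) ⟨ x ∷ xs ⟩ ()

⟨⟩⊕≢*R : ∀ gs X → ⟨ gs ⟩ ⊕ X ≢ *R
⟨⟩⊕≢*R (g ∷ gs) *L ()
⟨⟩⊕≢*R (g ∷ gs) *R ()
⟨⟩⊕≢*R (g ∷ gs) ⟨ x ∷ xs ⟩ ()

starL⊕≡*L⇒≡*L : ∀ n X → starL n ⊕ X ≡ *L → X ≡ *L
starL⊕≡*L⇒≡*L zero *L _ = refl
starL⊕≡*L⇒≡*L zero ⟨ x ∷ xs ⟩ ()
starL⊕≡*L⇒≡*L (suc n) X eq = contradiction eq (⟨⟩⊕≢*L (starL n ∷ starLs n) X)

starL⊕≡*R⇒≡*R : ∀ n X → starL n ⊕ X ≡ *R → X ≡ *R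
starL⊕≡*R⇒≡*R zero *R _ = refl
starL⊕≡*R⇒≡*R zero ⟨ x ∷ xs ⟩ ()
starL⊕≡*R⇒≡*R (suc n) X eq = contradiction eq (⟨⟩⊕≢*R (starL n ∷ starLs n) X)

starLs≡applyDownFrom : ∀ n → starLs n ≡ applyDownFrom starL n
starLs≡applyDownFrom zero = refl
starLs≡applyDownFrom (suc n) = cong (starL n ∷_) (starLs≡applyDownFrom n)

options-starL : ∀ n → options (starL n) ≡ applyDownFrom starL n
options-starL zero = refl
options-starL (suc n) = starLs≡applyDownFrom (suc n)

starL-∈-options : ∀ {m n} → m < n → starL m ∈ options (starL n)
starL-∈-options {n = n} m<n = subst (_ ∈_) (sym (options-starL n)) (∈-applyDownFrom⁺ starL m<n)

∈-options-starL⁻ : ∀ {g} n → g ∈ options (starL n) → ∃ λ m → m < n × g ≡ starL m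
∈-options-starL⁻ n g∈ = ∈-applyDownFrom⁻ starL (subst (_ ∈_) (options-starL n) g∈)

mutual
  starL-𝓛 : ∀ n → T (leftWinsFirst (starL n)) × T (leftWinsSecond (starL n))
  starL-𝓛 zero = _ , _
  starL-𝓛 (suc n) = from T-∨ (inj₁ (proj₂ (starL-𝓛 n))) , from T-∧ (proj₁ (starL-𝓛 n) , allLF-starLs n)

  allLF-starLs : ∀ n → T (allLF (starLs n))
  allLF-starLs zero = _
  allLF-starLs (suc n) = proj₂ (starL-𝓛 (suc n))

starL-leftWinsSecond⇒leftWinsFirst : ∀ {m n} X → m ≢ n →
  T (leftWinsSecond (starL m ⊕ X)) → T (leftWinsFirst (starL n ⊕ X))
starL-leftWinsSecond⇒leftWinsFirst {m} {n} X m≢n win with <-cmp m n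
... | tri< m<n _ _ = leftWinsFirst-⊕-option (starL n) X (inˡ (starL-∈-options m<n)) win
... | tri≈ _ m≡n _ = contradiction m≡n m≢n
... | tri> _ _ n<m = leftWinsSecond-⊕-option (starL m) X (inˡ (starL-∈-options n<m)) win

starL-∈-options-gameOf : ∀ {n} ns → n ∈ toList ns → starL n ∈ options (gameOf ns)
starL-∈-options-gameOf (_ ∷ _) = ∈-map⁺ starL

∈-options-gameOf⁻ : ∀ {g} ns → g ∈ options (gameOf ns) → ∃ λ n → n ∈ toList ns × g ≡ starL n
∈-options-gameOf⁻ (_ ∷ _) = ∈-map⁻ starL

gameOf-leftWinsFirst : ∀ ns → T (leftWinsFirst (gameOf ns))
gameOf-leftWinsFirst (n ∷ ns) = leftWinsFirst-option {gameOf (n ∷ ns)} (here refl) (proj₂ (starL-𝓛 n))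

gameOf⊕*L-leftWinsFirst : ∀ ns → T (leftWinsFirst (gameOf ns ⊕ *L))
gameOf⊕*L-leftWinsFirst ns =
  subst (T ∘ leftWinsFirst) (sym (⊕-identityʳ (gameOf ns))) (gameOf-leftWinsFirst ns)

gameOf⊕*R-¬leftWinsSecond : ∀ ns → ¬ T (leftWinsSecond (gameOf ns ⊕ *R))
gameOf⊕*R-¬leftWinsSecond ns win =
  subst T (to T-not-≡ (subst T (leftWinsSecond-⊕*R (gameOf ns)) win)) (gameOf-leftWinsFirst ns)

T-ext : ∀ {a b} → (T a → T b) → (T b → T a) → a ≡ b
T-ext {false} {false} _ _ = refl
T-ext {false} {true} _ b⇒a = ⊥-elim (b⇒a _)
T-ext {true} {false} a⇒b _ = ⊥-elim (a⇒b _)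
T-ext {true} {true} _ _ = refl

¬T-ext : ∀ {a b} → (¬ T a → ¬ T b) → (¬ T b → ¬ T a) → a ≡ b
¬T-ext {false} {false} _ _ = refl
¬T-ext {false} {true} ¬a⇒¬b _ = ⊥-elim (¬a⇒¬b (λ ()) _)
¬T-ext {true} {false} _ ¬b⇒¬a = ⊥-elim (¬b⇒¬a (λ ()) _)
¬T-ext {true} {true} _ _ = refl

options-induction : ∀ {ℓ} (P : Pos → Set ℓ) → (∀ X → All P (options X) → P X) → ∀ X → P X
options-induction P step = go
  where
  mutual
    go : ∀ X → P X
    go *L = step *L []
    go *R = step *R []
    go ⟨ x ∷ xs ⟩ = step ⟨ x ∷ xs ⟩ (go x ∷ go-all xs)

    go-all : ∀ xs → All P xs
    go-all [] = []
    go-all (x ∷ xs) = go x ∷ go-all xs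

module _ (ns : List⁺ ℕ) (a : ℕ) (mex : IsMex (toList ns) a) where
  private
    Y S : Pos
    Y = gameOf ns
    S = starL a

  AgreeFirst AgreeSecond : Pos → Set
  AgreeFirst X = leftWinsFirst (Y ⊕ X) ≡ leftWinsFirst (S ⊕ X)
  AgreeSecond X = leftWinsSecond (Y ⊕ X) ≡ leftWinsSecond (S ⊕ X)

  ∈-ns⇒≢a : ∀ {n} → n ∈ toList ns → n ≢ a
  ∈-ns⇒≢a n∈ refl = proj₁ mex n∈

  first-Y⇒S : ∀ X → All AgreeSecond (options X) →
              T (leftWinsFirst (Y ⊕ X)) → T (leftWinsFirst (S ⊕ X))
  first-Y⇒S X ih win with leftWinsFirst-elim win
  ... | inj₁ Y⊕X≡*L = contradiction Y⊕X≡*L (⟨⟩⊕≢*L _ X)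
  ... | inj₂ (w , w∈ , w-win) with ∈-options-⊕⁻ w∈
  ...   | inʳ x∈ = leftWinsFirst-⊕-option S X (inʳ x∈) (subst T (All.lookup ih x∈) w-win)
  ...   | inˡ y∈ with n , n∈ , refl ← ∈-options-gameOf⁻ ns y∈ =
    starL-leftWinsSecond⇒leftWinsFirst X (∈-ns⇒≢a n∈) w-win

  first-S⇒Y : ∀ X → All AgreeSecond (options X) →
              T (leftWinsFirst (S ⊕ X)) → T (leftWinsFirst (Y ⊕ X))
  first-S⇒Y X ih win with leftWinsFirst-elim win
  ... | inj₁ S⊕X≡*L with refl ← starL⊕≡*L⇒≡*L a X S⊕X≡*L = gameOf⊕*L-leftWinsFirst ns
  ... | inj₂ (w , w∈ , w-win) with ∈-options-⊕⁻ w∈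
  ...   | inʳ x∈ = leftWinsFirst-⊕-option Y X (inʳ x∈) (subst T (sym (All.lookup ih x∈)) w-win)
  ...   | inˡ s∈ with b , b<a , refl ← ∈-options-starL⁻ a s∈ =
    leftWinsFirst-⊕-option Y X (inˡ (starL-∈-options-gameOf ns (proj₂ mex b b<a))) w-win

  second-Y⇒S : ∀ X → All AgreeFirst (options X) →
               ¬ T (leftWinsSecond (Y ⊕ X)) → ¬ T (leftWinsSecond (S ⊕ X))
  second-Y⇒S X ih loss with leftWinsSecond-elim loss
  ... | inj₁ Y⊕X≡*R = contradiction Y⊕X≡*R (⟨⟩⊕≢*R _ X)
  ... | inj₂ (w , w∈ , w-loss) with ∈-options-⊕⁻ w∈
  ...   | inʳ x∈ = subst (¬_ ∘ T) (All.lookup ih x∈) w-loss ∘ leftWinsSecond-⊕-option S X (inʳ x∈)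
  ...   | inˡ y∈ with n , n∈ , refl ← ∈-options-gameOf⁻ ns y∈ =
    w-loss ∘ starL-leftWinsSecond⇒leftWinsFirst X (∈-ns⇒≢a n∈ ∘ sym)

  second-S⇒Y : ∀ X → All AgreeFirst (options X) →
               ¬ T (leftWinsSecond (S ⊕ X)) → ¬ T (leftWinsSecond (Y ⊕ X))
  second-S⇒Y X ih loss with leftWinsSecond-elim loss
  ... | inj₁ S⊕X≡*R with refl ← starL⊕≡*R⇒≡*R a X S⊕X≡*R = gameOf⊕*R-¬leftWinsSecond ns
  ... | inj₂ (w , w∈ , w-loss) with ∈-options-⊕⁻ w∈
  ...   | inʳ x∈ = subst (¬_ ∘ T) (sym (All.lookup ih x∈)) w-loss ∘ leftWinsSecond-⊕-option Y X (inʳ x∈)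
  ...   | inˡ s∈ with b , b<a , refl ← ∈-options-starL⁻ a s∈ =
    w-loss ∘ leftWinsSecond-⊕-option Y X (inˡ (starL-∈-options-gameOf ns (proj₂ mex b b<a)))

  agree : ∀ X → AgreeFirst X × AgreeSecond X
  agree = options-induction (λ X → AgreeFirst X × AgreeSecond X) λ X ih →
    let ih₁ = All.map proj₁ ih ; ih₂ = All.map proj₂ ih
    in T-ext (first-Y⇒S X ih₂) (first-S⇒Y X ih₂) , ¬T-ext (second-Y⇒S X ih₁) (second-S⇒Y X ih₁)

theorem3p3 : (as : List⁺ ℕ) (a : ℕ) → IsMex (toList as) a → gameOf as ≡ᵍ starL a
theorem3p3 as a mex X = cong₂ outcomeOf (proj₁ (agree as a mex X)) (proj₂ (agree as a mex X))
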